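{- Let $n=2m>3$ be an even integer and let $a,b$ be natural numbers with $1\le a<b\le n-1$. If $\gcd(a+b,n)>2$, then $a$ and $b$ do not induce an $n$-polygon with $m$ axes, i.e. the $n$-tuple of sides $(a,b,a,b,\ldots,a,b)$ does not represent an $n$-polygon with $m$ axes.
   Context: Fix the vertices $v_k=e^{2\pi i k/n}$, $k=0,\ldots,n-1$, on the unit circle. An $n$-polygon is a Hamiltonian cycle through these vertices: a closed path $v_{\sigma_1}\cdots v_{\sigma_n}v_{\sigma_1}$ of straight segments with $(\sigma_1,\ldots,\sigma_n)$ an ordering of $0,\ldots,n-1$. Its sides are the integers $e_i\in\{1,\ldots,n-1\}$ with $e_i\equiv\sigma_{i+1}-\sigma_i\pmod n$; an $n$-tuple of sides represents a polygon if starting at a vertex and moving counterclockwise successively by the sides visits each vertex exactly once before returning to the start after the $n$-th step. An $n$-polygon with $m$ axes is one with exactly $m$ axes of reflection symmetry. -}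

module Defs where

open import Data.Nat using (ℕ; zero; suc; _+_; _*_; _∸_; _<_; _≡ᵇ_; NonZero)
open import Data.Nat.DivMod using (_/_; _%_)
open import Data.Bool using (Bool; true; false; _∧_; _∨_)
open import Data.List using (List; upTo; filterᵇ; length)
open import Data.Bool.ListAction using (all; any)
open import Relation.Binary.PropositionalEquality using (_≡_)

-- Vertices v_k = e^{2πik/n} are identified with k ∈ {0,…,n-1} (arithmetic mod n).

-- Raw (unreduced) position after i counterclockwise steps from vertex 0 along the
-- side tuple (a,b,a,b,…): after 2q steps we moved q(a+b), after 2q+1 steps q(a+b)+a.
abPos : ℕ → ℕ → ℕ → ℕ
abPos a b i = (i / 2) * (a + b) + (i % 2) * a

abVert : (n : ℕ) → .{{NonZero n}} → ℕ → ℕ → ℕ → ℕ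
abVert n a b i = abPos a b i % n

-- The n-tuple of sides (a,b,…,a,b) represents an n-polygon: starting at a vertex
-- (w.l.o.g. vertex 0) the first n steps visit each vertex exactly once (the
-- vertices after steps 0,…,n-1 are pairwise distinct) and step n returns to the start.
RepresentsPolygon : (n : ℕ) → .{{NonZero n}} → ℕ → ℕ → Set
RepresentsPolygon n a b =
  ((i j : ℕ) → i < n → j < n → abVert n a b i ≡ abVert n a b j → i ≡ j)
  × (abVert n a b n ≡ 0)
  where open import Data.Product using (_×_)

-- Reflection axes of the regular n-gon's vertex set: the reflections k ↦ c - k (mod n),
-- c = 0,…,n-1 (n distinct axes through the centre).
reflect : (n : ℕ) → .{{NonZero n}} → ℕ → ℕ → ℕ
reflect n c x = (c + n ∸ x) % n

sameEdge : ℕ → ℕ → ℕ → ℕ → Bool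
sameEdge x y u v = ((x ≡ᵇ u) ∧ (y ≡ᵇ v)) ∨ ((x ≡ᵇ v) ∧ (y ≡ᵇ u))

-- The reflection with parameter c is a symmetry of the polygon (a,b,…,a,b) started at 0:
-- it maps every side {v_{p_i}, v_{p_{i+1}}} (i = 0,…,n-1) onto a side of the polygon.
-- (Reflections are injective, so this means the side set is mapped onto itself.)
isAxis : (n : ℕ) → .{{NonZero n}} → ℕ → ℕ → ℕ → Bool
isAxis n a b c =
  all (λ i → any (λ j → sameEdge (reflect n c (abVert n a b i))
                                 (reflect n c (abVert n a b (suc i)))
                                 (abVert n a b j)
                                 (abVert n a b (suc j)))
                 (upTo n))
      (upTo n)

numAxes : (n : ℕ) → .{{NonZero n}} → ℕ → ℕ → ℕ
numAxes n a b = length (filterᵇ (isAxis n a b) (upTo n))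

{-# OPTIONS --safe #-}
module Submission where

-- Let d = gcd(a + b, n) and n = q d. After 2q steps the walk (a,b,a,b,…) has
-- moved q (a + b), a multiple of q d = n, so it is back at the start; since
-- d > 2 this happens at step 2q < n. Hence (a,b,…,a,b) does not represent an
-- n-polygon at all, whatever its number of axes.

open import Defs
open import Data.Nat using (ℕ; NonZero; _*_; _+_; _∸_; _≤_; _<_; >-nonZero⁻¹)
open import Data.Nat.DivMod using (_/_; _%_; m*n%n≡0; m*n/n≡m)
open import Data.Nat.Divisibility using (_∣_; n∣m⇒m%n≡0; *-monoʳ-∣; quotient; quotient≢0; m∣n⇒n≡quotient*m)
open import Data.Nat.GCD using (gcd; gcd[m,n]∣m; gcd[m,n]∣n)
open import Data.Nat.Properties using (+-identityʳ; <⇒≢; *-monoʳ-<; m≤m*n; <-≤-trans; ≤-reflexive)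
open import Data.Product using (_×_; _,_; proj₁)
open import Relation.Binary.PropositionalEquality using (_≡_; sym; trans; cong; cong₂; subst; module ≡-Reasoning)
open import Relation.Nullary using (¬_)

abPos-even : (a b q : ℕ) → abPos a b (q * 2) ≡ q * (a + b)
abPos-even a b q = begin
  (q * 2 / 2) * (a + b) + (q * 2 % 2) * a
    ≡⟨ cong₂ (λ x y → x * (a + b) + y * a) (m*n/n≡m q 2) (m*n%n≡0 q 2) ⟩
  q * (a + b) + 0
    ≡⟨ +-identityʳ _ ⟩
  q * (a + b) ∎
  where open ≡-Reasoning

abVert-even≡0 : (n : ℕ) .{{_ : NonZero n}} (a b q : ℕ) →
                n ∣ q * (a + b) → abVert n a b (q * 2) ≡ 0
abVert-even≡0 n a b q n∣q[a+b] =
  trans (cong (_% n) (abPos-even a b q)) (n∣m⇒m%n≡0 _ n n∣q[a+b])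

¬RepresentsPolygon-if-returns-early : (n : ℕ) .{{_ : NonZero n}} (a b k : ℕ) →
  0 < k → k < n → abVert n a b k ≡ 0 → ¬ RepresentsPolygon n a b
¬RepresentsPolygon-if-returns-early n a b k 0<k k<n returns (injective , _) =
  <⇒≢ 0<k (sym (injective k 0 k<n (>-nonZero⁻¹ n) (trans returns (sym (m*n%n≡0 0 n)))))

theorem4 : (n m a b : ℕ) → .{{_ : NonZero n}} → n ≡ 2 * m → 3 < n
    → 1 ≤ a → a < b → b ≤ n ∸ 1 → 2 < gcd (a + b) n
    → ¬ (RepresentsPolygon n a b × numAxes n a b ≡ m)
theorem4 n m a b _ _ _ _ _ 2<d polygon =
  ¬RepresentsPolygon-if-returns-early n a b (q * 2) 0<2q 2q<n
    (abVert-even≡0 n a b q n∣q[a+b]) (proj₁ polygon)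
  where
  d : ℕ
  d = gcd (a + b) n
  d∣n : d ∣ n
  d∣n = gcd[m,n]∣n (a + b) n
  q : ℕ
  q = quotient d∣n
  instance
    q≢0 : NonZero q
    q≢0 = quotient≢0 d∣n
  n≡qd : n ≡ q * d
  n≡qd = m∣n⇒n≡quotient*m d∣n
  n∣q[a+b] : n ∣ q * (a + b)
  n∣q[a+b] = subst (_∣ q * (a + b)) (sym n≡qd) (*-monoʳ-∣ q (gcd[m,n]∣m (a + b) n))
  0<2q : 0 < q * 2
  0<2q = <-≤-trans (>-nonZero⁻¹ q) (m≤m*n q 2)
  2q<n : q * 2 < n
  2q<n = <-≤-trans (*-monoʳ-< q 2<d) (≤-reflexive (sym n≡qd))
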